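{- Let $F$ be a hypergraph with no two separated edges, i.e. there are no two edges $E_1,E_2$ of $F$ with $E_1<E_2$ (every element of $E_1$ smaller than every element of $E_2$). Let $p=v(F)$ and $q=e(F)>1$. Then for every $n\in\mathbb{N}$, $$\mathrm{ex}_i(F,n)\le (2p-1)(q-1)\cdot\mathrm{ex}_e(F,n).$$
   Context: A hypergraph $H=(E_i: i\in I)$ is a finite list of finite nonempty subsets of $\mathbb{N}$ (edges; repetitions allowed); it is simple if its edges are pairwise distinct. Its vertex set is $\bigcup H=\bigcup_i E_i$, $v(H)=|\bigcup H|$, $e(H)=|I|$, and $i(H)=\sum_{i\in I}|E_i|$. $H$ contains $H'=(E'_i:i\in I')$, written $H\succ H'$, if there exist an increasing injection $\phi:\bigcup H'\to\bigcup H$ and an injection $f:I'\to I$ such that $v\in E'_i$ implies $\phi(v)\in E_{f(i)}$ for all $v$ and $i\in I'$; otherwise $H$ is $H'$-free. For a hypergraph $F$, $\mathrm{ex}_e(F,n)=\max\{e(H): H\not\succ F,\ H \text{ simple},\ v(H)\le n\}$ and $\mathrm{ex}_i(F,n)=\max\{i(H): H\not\succ F,\ H\text{ simple},\ v(H)\le n\}$. -}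

module Defs where

open import Data.Nat using (ℕ; _<_; _≤_; _*_; _∸_; _+_)
open import Data.Nat.Properties using (_≟_)
open import Data.List using (List; []; _∷_; length; map; concat; lookup; deduplicate)
open import Data.Nat.ListAction using (sum)
open import Data.List.Relation.Unary.All using (All)
open import Data.List.Relation.Unary.Linked using (Linked)
open import Data.List.Relation.Unary.Unique.Propositional using (Unique)
open import Data.List.Membership.Propositional using (_∈_)
open import Data.Fin using (Fin)
open import Data.Product using (Σ; _×_; ∃)
open import Relation.Nullary using (¬_)
open import Function.Definitions using (Injective)
open import Relation.Binary.PropositionalEquality using (_≡_)

-- A finite nonempty subset of ℕ is represented canonically by the
-- strictly increasing (hence duplicate-free) nonempty list of its elements.
NonEmptyList : List ℕ → Set
NonEmptyList [] = Data.Empty.⊥ where import Data.Empty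
NonEmptyList (_ ∷ _) = Data.Unit.⊤ where import Data.Unit

IsEdge : List ℕ → Set
IsEdge E = NonEmptyList E × Linked _<_ E

Hypergraph : Set
Hypergraph = List (List ℕ)

IsHypergraph : Hypergraph → Set
IsHypergraph H = All IsEdge H

-- simple: edges pairwise distinct (as sets; representation is canonical)
Simple : Hypergraph → Set
Simple H = Unique H

vertices : Hypergraph → List ℕ
vertices H = deduplicate _≟_ (concat H)

v : Hypergraph → ℕ
v H = length (vertices H)

e : Hypergraph → ℕ
e H = length H

i : Hypergraph → ℕ
i H = sum (map length H)

_≻_ : Hypergraph → Hypergraph → Set
H ≻ H' =
  Σ (ℕ → ℕ) λ φ → Σ (Fin (length H') → Fin (length H)) λ f →
    (∀ {a b} → a ∈ concat H' → b ∈ concat H' → a < b → φ a < φ b) ×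
    Injective _≡_ _≡_ f ×
    (∀ j {a} → a ∈ lookup H' j → φ a ∈ lookup H (f j))

NoSeparatedEdges : Hypergraph → Set
NoSeparatedEdges F =
  ¬ (Σ (Fin (length F)) λ j → Σ (Fin (length F)) λ k →
       ∀ {a b} → a ∈ lookup F j → b ∈ lookup F k → a < b)

-- the admissible hypergraphs in the definition of ex(F, n)
Admissible : Hypergraph → ℕ → Hypergraph → Set
Admissible F n H = IsHypergraph H × Simple H × ¬ (H ≻ F) × v H ≤ n

ExEBound : Hypergraph → ℕ → ℕ → Set
ExEBound F n m = ∀ H → Admissible F n H → e H ≤ m

IsExE : Hypergraph → ℕ → ℕ → Set
IsExE F n m = (Σ Hypergraph λ H → Admissible F n H × e H ≡ m) × ExEBound F n m

{-# OPTIONS --safe #-}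
-- Cut every edge of H into consecutive blocks of p = v(F) vertices, the last one
-- taking the remainder: each block has at most 2p - 1 vertices and is either the
-- whole edge or has at least p vertices. The distinct blocks form a simple
-- hypergraph D on the vertices of H which is F-free, since two edges of F sent to
-- blocks of one edge of H would be separated; so e(D) ≤ ex_e(F, n). A block X lies
-- in at most q - 1 edges of H: if |X| < p it is itself an edge and H is simple,
-- and if |X| ≥ p and X lay in q edges, mapping the vertices of F in order into X
-- would embed F into H. Hence i(H) ≤ (2p - 1) · #blocks ≤ (2p - 1)(q - 1) · e(D).
module Submission where

open import Defs
open import Data.Nat using (ℕ; zero; suc; _+_; _*_; _∸_; _⊓_; _≤_; _<_; z≤n; s≤s; _<?_; _≤?_)
open import Data.Nat.Properties hiding (suc-injective)
open import Data.Fin as Fin using (Fin; zero; suc)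
open import Data.Fin.Properties using (suc-injective; inject≤-injective)
open import Data.List
  using (List; []; _∷_; [_]; length; _++_; concat; concatMap; map; lookup; filter; take; drop; deduplicate)
open import Data.Nat.ListAction using (sum)
open import Data.List.Properties
  using (length-++; filter-++; filter-none; filter-notAll; length-take; length-drop; take++drop≡id; ++-identityʳ; ≡-dec)
open import Data.List.Relation.Unary.All as All using (All; []; _∷_)
import Data.List.Relation.Unary.All.Properties as All
open import Data.List.Relation.Unary.Any as Any using (Any; here; there)
open import Data.List.Relation.Unary.Any.Properties using (lookup-index)
open import Data.List.Relation.Unary.AllPairs using (AllPairs; []; _∷_)
open import Data.List.Relation.Unary.Linked.Properties using (Linked⇒AllPairs; AllPairs⇒Linked)
open import Data.List.Relation.Unary.Unique.Propositional using (Unique)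
open import Data.List.Relation.Unary.Unique.DecPropositional.Properties using (deduplicate-!)
open import Data.List.Membership.Propositional using (_∈_; _∉_)
open import Data.List.Membership.Propositional.Properties
  using ( ∈-++⁺ʳ; ∈-concat⁺′; ∈-concat⁻′; ∈-concatMap⁻; ∈-deduplicate⁺; ∈-deduplicate⁻
        ; ∈-filter⁺; ∈-filter⁻; ∈-lookup)
import Data.List.Membership.DecPropositional as DecMembership
open import Data.List.Relation.Binary.Sublist.Propositional using (_⊆_; ⊆-refl)
open import Data.List.Relation.Binary.Pointwise using (Pointwise-≡⇒≡)
open import Data.List.Relation.Binary.Sublist.Propositional.Properties as Sublist
  using (length-mono-≤; filter-⊆)
open import Data.Empty using (⊥-elim)
open import Data.Unit using (tt)
open import Data.Sum using (_⊎_; inj₁; inj₂)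
open import Data.Product using (Σ; _×_; _,_; proj₁; proj₂)
open import Function using (_∘_; id)
open import Function.Definitions using (Injective)
open import Level using (Level; 0ℓ)
open import Relation.Binary using (Rel; DecidableEquality; tri<; tri≈; tri>)
open import Relation.Binary.PropositionalEquality using (_≡_; _≢_; refl; sym; trans; cong; subst)
open import Relation.Nullary using (¬_; yes; no)
open import Relation.Unary using (Pred; Decidable)
open import Relation.Unary.Properties using (∁?)

private
  variable
    ℓ : Level

<⇒≤∸1 : ∀ {m n} → m < n → m ≤ n ∸ 1
<⇒≤∸1 {m} {n} m<n = subst (m ≤_) (pred[m∸n]≡m∸[1+n] n 0) (<⇒≤pred m<n)

module _ {A : Set} {P : Pred A ℓ} (P? : Decidable P) where

  length-filter+∁ : ∀ xs → length (filter P? xs) + length (filter (∁? P?) xs) ≡ length xs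
  length-filter+∁ [] = refl
  length-filter+∁ (x ∷ xs) with P? x
  ... | yes _ = cong suc (length-filter+∁ xs)
  ... | no _  = trans (+-suc _ _) (cong suc (length-filter+∁ xs))

  filter-index : ∀ xs → Σ (Fin (length (filter P? xs)) → Fin (length xs)) λ ι →
                   Injective _≡_ _≡_ ι × (∀ j → P (lookup xs (ι j)))
  filter-index [] = (λ ()) , (λ {}) , (λ ())
  filter-index (x ∷ xs) with P? x | filter-index xs
  ... | no _   | ι , ι-inj , Pι = suc ∘ ι , ι-inj ∘ suc-injective , Pι
  ... | yes Px | ι , ι-inj , Pι = ι′ , ι′-inj , Pι′
    where
    ι′ : Fin (suc (length (filter P? xs))) → Fin (suc (length xs))
    ι′ zero    = zero
    ι′ (suc j) = suc (ι j)
    ι′-inj : Injective _≡_ _≡_ ι′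
    ι′-inj {zero}  {zero}  _  = refl
    ι′-inj {suc j} {suc k} eq = cong suc (ι-inj (suc-injective eq))
    Pι′ : ∀ j → P (lookup (x ∷ xs) (ι′ j))
    Pι′ zero    = Px
    Pι′ (suc j) = Pι j

module Multiplicity {A : Set} (_≟_ : DecidableEquality A) where

  count : A → List A → ℕ
  count x xs = length (filter (x ≟_) xs)

  count-++ : ∀ x xs ys → count x (xs ++ ys) ≡ count x xs + count x ys
  count-++ x xs ys = trans (cong length (filter-++ (x ≟_) xs ys)) (length-++ (filter (x ≟_) xs))

  count-∉ : ∀ {x xs} → x ∉ xs → count x xs ≡ 0
  count-∉ {x} x∉xs = cong length (filter-none (x ≟_) (All.tabulate λ { y∈xs refl → x∉xs y∈xs }))

  count-unique : ∀ x {xs} → Unique xs → count x xs ≤ 1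
  count-unique x {[]}     []            = z≤n
  count-unique x {y ∷ ys} (y∉ys ∷ ys!) with x ≟ y
  ... | yes refl = s≤s (≤-reflexive (count-∉ λ x∈ys → All.lookup y∉ys x∈ys refl))
  ... | no _     = count-unique x ys!

  count-filter : ∀ x {P : Pred A ℓ} (P? : Decidable P) xs → count x (filter P? xs) ≤ count x xs
  count-filter x P? xs =
    length-mono-≤ (Sublist.filter⁺ (x ≟_) (x ≟_) (λ { refl → id }) (filter-⊆ P? xs))

  count≤⇒length≤ : ∀ c ys {xs} → (∀ x → count x xs ≤ c) → (∀ {x} → x ∈ xs → x ∈ ys) →
                   length xs ≤ c * length ys
  count≤⇒length≤ c []       {[]}    _ _ = z≤n
  count≤⇒length≤ c []       {x ∷ _} _ xs⊆[] with () ← xs⊆[] (here refl)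
  count≤⇒length≤ c (y ∷ ys) {xs} count≤c xs⊆ = begin
    length xs                  ≡⟨ length-filter+∁ (y ≟_) xs ⟨
    count y xs + length others ≤⟨ +-mono-≤ (count≤c y) (count≤⇒length≤ c ys others-count≤c others⊆ys) ⟩
    c + c * length ys          ≡⟨ *-suc c (length ys) ⟨
    c * length (y ∷ ys)        ∎
    where
    open ≤-Reasoning
    others = filter (∁? (y ≟_)) xs
    others-count≤c : ∀ x → count x others ≤ c
    others-count≤c x = ≤-trans (count-filter x (∁? (y ≟_)) xs) (count≤c x)
    others⊆ys : ∀ {x} → x ∈ others → x ∈ ys
    others⊆ys x∈others with x∈xs , y≢x ← ∈-filter⁻ (∁? (y ≟_)) x∈others with xs⊆ x∈xs
    ... | here refl  = ⊥-elim (y≢x refl)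
    ... | there x∈ys = x∈ys

  Unique-⊆⇒length≤ : ∀ {xs ys} → Unique xs → (∀ {x} → x ∈ xs → x ∈ ys) →
                     length xs ≤ length ys
  Unique-⊆⇒length≤ {xs} {ys} xs! xs⊆ys = begin
    length xs      ≤⟨ count≤⇒length≤ 1 ys (λ x → count-unique x xs!) xs⊆ys ⟩
    1 * length ys  ≡⟨ *-identityˡ (length ys) ⟩
    length ys      ∎
    where open ≤-Reasoning

  open DecMembership _≟_ using (_∈?_)

  count-concatMap≤ : ∀ {B : Set} (f : B → List A) x ys → All (Unique ∘ f) ys →
                     count x (concatMap f ys) ≤ length (filter (λ y → x ∈? f y) ys)
  count-concatMap≤ f x []       []           = z≤n
  count-concatMap≤ f x (y ∷ ys) (fy! ∷ fys!) with x ∈? f y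
  ... | yes _ = begin
    count x (f y ++ concatMap f ys)          ≡⟨ count-++ x (f y) _ ⟩
    count x (f y) + count x (concatMap f ys)
      ≤⟨ +-mono-≤ (count-unique x fy!) (count-concatMap≤ f x ys fys!) ⟩
    suc (length (filter (λ z → x ∈? f z) ys)) ∎
    where open ≤-Reasoning
  ... | no x∉fy = begin
    count x (f y ++ concatMap f ys)          ≡⟨ count-++ x (f y) _ ⟩
    count x (f y) + count x (concatMap f ys) ≡⟨ cong (_+ _) (count-∉ x∉fy) ⟩
    count x (concatMap f ys)                 ≤⟨ count-concatMap≤ f x ys fys! ⟩
    length (filter (λ z → x ∈? f z) ys)       ∎
    where open ≤-Reasoning

Unique⇒lookup-injective : ∀ {A : Set} {xs : List A} → Unique xs → Injective _≡_ _≡_ (lookup xs)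
Unique⇒lookup-injective {xs = _ ∷ _} _         {zero}  {zero}  _  = refl
Unique⇒lookup-injective {xs = _ ∷ _} (x∉ ∷ _)  {zero}  {suc k} eq = ⊥-elim (All.lookup x∉ (∈-lookup k) eq)
Unique⇒lookup-injective {xs = _ ∷ _} (x∉ ∷ _)  {suc j} {zero}  eq =
  ⊥-elim (All.lookup x∉ (∈-lookup j) (sym eq))
Unique⇒lookup-injective {xs = _ ∷ _} (_ ∷ xs!) {suc j} {suc k} eq =
  cong suc (Unique⇒lookup-injective xs! eq)

Precedes : {A : Set} → Rel A ℓ → Rel (List A) ℓ
Precedes R X Y = ∀ {x y} → x ∈ X → y ∈ Y → R x y

module _ {A : Set} {R : Rel A ℓ} where

  AllPairs-++⁻ˡ : ∀ xs {ys} → AllPairs R (xs ++ ys) → AllPairs R xs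
  AllPairs-++⁻ˡ []       _            = []
  AllPairs-++⁻ˡ (x ∷ xs) (Rx ∷ Rxsys) = All.++⁻ˡ xs Rx ∷ AllPairs-++⁻ˡ xs Rxsys

  AllPairs-++⁻ʳ : ∀ xs {ys} → AllPairs R (xs ++ ys) → AllPairs R ys
  AllPairs-++⁻ʳ []       Rys         = Rys
  AllPairs-++⁻ʳ (x ∷ xs) (_ ∷ Rxsys) = AllPairs-++⁻ʳ xs Rxsys

  AllPairs-++⁻-Precedes : ∀ xs {ys} → AllPairs R (xs ++ ys) → Precedes R xs ys
  AllPairs-++⁻-Precedes (x ∷ xs) (Rx ∷ _)     (here refl) y∈ys = All.lookup Rx (∈-++⁺ʳ xs y∈ys)
  AllPairs-++⁻-Precedes (x ∷ xs) (_ ∷ Rxsys) (there x∈xs) y∈ys =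
    AllPairs-++⁻-Precedes xs Rxsys x∈xs y∈ys

  AllPairs-concat⁻-All : ∀ xss → AllPairs R (concat xss) → All (AllPairs R) xss
  AllPairs-concat⁻-All []         _  = []
  AllPairs-concat⁻-All (xs ∷ xss) Rc =
    AllPairs-++⁻ˡ xs Rc ∷ AllPairs-concat⁻-All xss (AllPairs-++⁻ʳ xs Rc)

  AllPairs-concat⁻-Precedes : ∀ xss → AllPairs R (concat xss) → AllPairs (Precedes R) xss
  AllPairs-concat⁻-Precedes []         _  = []
  AllPairs-concat⁻-Precedes (xs ∷ xss) Rc =
    All.tabulate (λ ys∈xss x∈xs y∈ys → AllPairs-++⁻-Precedes xs Rc x∈xs (∈-concat⁺′ y∈ys ys∈xss))
    ∷ AllPairs-concat⁻-Precedes xss (AllPairs-++⁻ʳ xs Rc)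

  AllPairs-∈⇒⊎ : ∀ {xs x y} → AllPairs R xs → x ∈ xs → y ∈ xs → x ≢ y → R x y ⊎ R y x
  AllPairs-∈⇒⊎ (_ ∷ _)   (here refl)  (here refl)  x≢y = ⊥-elim (x≢y refl)
  AllPairs-∈⇒⊎ (Rx ∷ _)  (here refl)  (there y∈xs) _   = inj₁ (All.lookup Rx y∈xs)
  AllPairs-∈⇒⊎ (Ry ∷ _)  (there x∈xs) (here refl)  _   = inj₂ (All.lookup Ry x∈xs)
  AllPairs-∈⇒⊎ (_ ∷ Rxs) (there x∈xs) (there y∈xs) x≢y = AllPairs-∈⇒⊎ Rxs x∈xs y∈xs x≢y

length-concat≤ : ∀ {A : Set} c (xss : List (List A)) → All (λ xs → length xs ≤ c) xss →
                 length (concat xss) ≤ c * length xss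
length-concat≤ c []         []                = z≤n
length-concat≤ c (xs ∷ xss) (|xs|≤c ∷ |xss|≤c) = begin
  length (xs ++ concat xss)       ≡⟨ length-++ xs ⟩
  length xs + length (concat xss) ≤⟨ +-mono-≤ |xs|≤c (length-concat≤ c xss |xss|≤c) ⟩
  c + c * length xss              ≡⟨ *-suc c (length xss) ⟨
  c * length (xs ∷ xss)           ∎
  where open ≤-Reasoning

_≺_ : Rel (List ℕ) 0ℓ
_≺_ = Precedes _<_

≺-irrefl : ∀ {X} → NonEmptyList X → ¬ X ≺ X
≺-irrefl {_ ∷ _} _ X≺X = <-irrefl refl (X≺X (here refl) (here refl))

AllPairs-≺⇒Unique : ∀ {Xs} → All NonEmptyList Xs → AllPairs _≺_ Xs → Unique Xs
AllPairs-≺⇒Unique []          []          = []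
AllPairs-≺⇒Unique (X≠[] ∷ ne) (X≺ ∷ ≺Xs) =
  All.map (λ { X≺Y refl → ≺-irrefl X≠[] X≺Y }) X≺ ∷ AllPairs-≺⇒Unique ne ≺Xs

module Blocks (p : ℕ) where

  -- Cut off blocks of length p while at least 2p elements remain; the remainder
  -- is the last block. The fuel length E suffices as p ≥ 1.
  split : {A : Set} → ℕ → List A → List (List A)
  split zero    E = [ E ]
  split (suc k) E with length E <? 2 * p
  ... | yes _ = [ E ]
  ... | no _  = take p E ∷ split k (drop p E)

  blocks : {A : Set} → List A → List (List A)
  blocks E = split (length E) E

  module _ {A : Set} where

    concat-split : ∀ k (E : List A) → concat (split k E) ≡ E
    concat-split zero    E = ++-identityʳ E
    concat-split (suc k) E with length E <? 2 * p
    ... | yes _ = ++-identityʳ E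
    ... | no _  = trans (cong (take p E ++_) (concat-split k (drop p E))) (take++drop≡id p E)

    concat-blocks : ∀ (E : List A) → concat (blocks E) ≡ E
    concat-blocks E = concat-split (length E) E

    split-long-or-whole : ∀ k (E : List A) {X} → X ∈ split k E → p ≤ length X ⊎ X ≡ E
    split-long-or-whole zero    E (here refl) = inj₂ refl
    split-long-or-whole (suc k) E X∈ with length E <? 2 * p
    split-long-or-whole (suc k) E (here refl) | yes _ = inj₂ refl
    split-long-or-whole (suc k) E (here refl) | no |E|≮2p = inj₁ (begin
      p                 ≡⟨ m≤n⇒m⊓n≡m (≤-trans (m≤m+n p _) (≮⇒≥ |E|≮2p)) ⟨
      p ⊓ length E      ≡⟨ length-take p E ⟨
      length (take p E) ∎)
      where open ≤-Reasoning
    split-long-or-whole (suc k) E (there X∈) | no |E|≮2p with split-long-or-whole k (drop p E) X∈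
    ... | inj₁ p≤|X|  = inj₁ p≤|X|
    ... | inj₂ refl = inj₁ (subst (p ≤_) (sym (length-drop p E)) (m+n≤o⇒m≤o∸n p p+p≤|E|))
      where
      p+p≤|E| : p + p ≤ length E
      p+p≤|E| = subst (_≤ length E) (cong (p +_) (+-identityʳ p)) (≮⇒≥ |E|≮2p)

    blocks-long-or-whole : ∀ (E : List A) {X} → X ∈ blocks E → p ≤ length X ⊎ X ≡ E
    blocks-long-or-whole E = split-long-or-whole (length E) E

    module _ (1≤p : 1 ≤ p) where

      p<2p : p < 2 * p
      p<2p = m<m+n p (≤-trans 1≤p (m≤m+n p 0))

      split-short : ∀ k (E : List A) → length E ≤ k → All (λ X → length X < 2 * p) (split k E)
      split-short zero    E |E|≤0 = ≤-<-trans |E|≤0 (≤-<-trans z≤n p<2p) ∷ []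
      split-short (suc k) E |E|≤1+k with length E <? 2 * p
      ... | yes |E|<2p = |E|<2p ∷ []
      ... | no _       =
        ≤-<-trans (≤-reflexive (length-take p E)) (≤-<-trans (m⊓n≤m p _) p<2p)
        ∷ split-short k (drop p E) |drop|≤k
        where
        |drop|≤k : length (drop p E) ≤ k
        |drop|≤k = begin
          length (drop p E) ≡⟨ length-drop p E ⟩
          length E ∸ p      ≤⟨ ∸-monoʳ-≤ (length E) 1≤p ⟩
          length E ∸ 1      ≤⟨ ∸-monoˡ-≤ 1 |E|≤1+k ⟩
          k                 ∎
          where open ≤-Reasoning

      blocks-short : ∀ (E : List A) → All (λ X → length X ≤ 2 * p ∸ 1) (blocks E)
      blocks-short E = All.map <⇒≤∸1 (split-short (length E) E ≤-refl)

      sum-length≤ : ∀ (H : List (List A)) →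
                    sum (map length H) ≤ (2 * p ∸ 1) * length (concatMap blocks H)
      sum-length≤ []      = z≤n
      sum-length≤ (E ∷ H) = begin
        length E + sum (map length H)                   ≤⟨ +-mono-≤ |E|≤ (sum-length≤ H) ⟩
        c * length (blocks E) + c * length (concatMap blocks H) ≡⟨ *-distribˡ-+ c _ _ ⟨
        c * (length (blocks E) + length (concatMap blocks H))   ≡⟨ cong (c *_) (length-++ (blocks E)) ⟨
        c * length (concatMap blocks (E ∷ H))           ∎
        where
        open ≤-Reasoning
        c = 2 * p ∸ 1
        |E|≤ : length E ≤ c * length (blocks E)
        |E|≤ = subst (λ E′ → length E′ ≤ c * length (blocks E)) (concat-blocks E)
                     (length-concat≤ c (blocks E) (blocks-short E))

  blocks-nonEmpty : 1 ≤ p → ∀ {E} → NonEmptyList E → All NonEmptyList (blocks E)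
  blocks-nonEmpty 1≤p {E} E≠[] = All.tabulate nonEmpty
    where
    long⇒nonEmpty : ∀ {X} → p ≤ length X → NonEmptyList X
    long⇒nonEmpty {[]}    p≤0 = ⊥-elim (<-irrefl refl (≤-trans 1≤p p≤0))
    long⇒nonEmpty {_ ∷ _} _   = tt
    nonEmpty : ∀ {X} → X ∈ blocks E → NonEmptyList X
    nonEmpty X∈ with blocks-long-or-whole E X∈
    ... | inj₁ p≤|X| = long⇒nonEmpty p≤|X|
    ... | inj₂ refl  = E≠[]

rank : ℕ → List ℕ → ℕ
rank a V = length (filter (_<? a) V)

filter<-⊆ : ∀ {a b} V → a ≤ b → filter (_<? a) V ⊆ filter (_<? b) V
filter<-⊆ {a} {b} V a≤b =
  Sublist.filter⁺ (_<? a) (_<? b) {as = V} (λ { refl y<a → <-≤-trans y<a a≤b }) ⊆-refl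

rank<length : ∀ {a V} → a ∈ V → rank a V < length V
rank<length {a} {V} a∈V = filter-notAll (_<? a) V (Any.map (λ { refl → <-irrefl refl }) a∈V)

-- The inclusion of the sublists below a and below b is strict, as only the latter contains a.
rank-strictMono : ∀ {a b} V → a < b → a ∈ V → rank a V < rank b V
rank-strictMono {a} {b} V a<b a∈V = ≤∧≢⇒< (length-mono-≤ below-a⊆below-b) λ same-length →
  let below-a≡below-b = Pointwise-≡⇒≡ (Sublist.to-≋ same-length below-a⊆below-b)
  in a∉below-a (subst (a ∈_) (sym below-a≡below-b) a∈below-b)
  where
  below-a⊆below-b = filter<-⊆ V (<⇒≤ a<b)
  a∈below-b : a ∈ filter (_<? b) V
  a∈below-b = ∈-filter⁺ (_<? b) a∈V a<b
  a∉below-a : a ∉ filter (_<? a) V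
  a∉below-a a∈below-a = <-irrefl refl (proj₂ (∈-filter⁻ (_<? a) {xs = V} a∈below-a))

-- The default 0 is never read: only indices below the length are used.
nth : List ℕ → ℕ → ℕ
nth []       _       = 0
nth (x ∷ _)  zero    = x
nth (_ ∷ xs) (suc k) = nth xs k

nth-∈ : ∀ X {k} → k < length X → nth X k ∈ X
nth-∈ (x ∷ X) {zero}  _           = here refl
nth-∈ (x ∷ X) {suc k} (s≤s k<|X|) = there (nth-∈ X k<|X|)

nth-strictMono : ∀ {X k l} → AllPairs _<_ X → k < l → l < length X → nth X k < nth X l
nth-strictMono {x ∷ X} {zero}  {suc l} (x< ∷ _) _         (s≤s l<|X|) = All.lookup x< (nth-∈ X l<|X|)
nth-strictMono {x ∷ X} {suc k} {suc l} (_ ∷ <X) (s≤s k<l) (s≤s l<|X|) = nth-strictMono <X k<l l<|X|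

lookup⊆concat : ∀ (G : Hypergraph) j {a} → a ∈ lookup G j → a ∈ concat G
lookup⊆concat G j a∈ = ∈-concat⁺′ a∈ (∈-lookup {xs = G} j)

-- Send the vertices of F, in increasing order, to the first v F elements of X.
≻-from-shared-subset : ∀ F H {X} → AllPairs _<_ X → v F ≤ length X →
  (f : Fin (e F) → Fin (e H)) → Injective _≡_ _≡_ f →
  (∀ j {a} → a ∈ X → a ∈ lookup H (f j)) → H ≻ F
≻-from-shared-subset F H {X} sorted p≤|X| f f-inj X⊆ = φ , f , φ-mono , f-inj , φ-sends
  where
  V = vertices F
  φ : ℕ → ℕ
  φ a = nth X (rank a V)
  vertex : ∀ {a} → a ∈ concat F → a ∈ V
  vertex = ∈-deduplicate⁺ _≟_
  rank<|X| : ∀ {a} → a ∈ concat F → rank a V < length X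
  rank<|X| a∈F = <-≤-trans (rank<length (vertex a∈F)) p≤|X|
  φ-mono : ∀ {a b} → a ∈ concat F → b ∈ concat F → a < b → φ a < φ b
  φ-mono a∈F b∈F a<b = nth-strictMono sorted (rank-strictMono V a<b (vertex a∈F)) (rank<|X| b∈F)
  φ-sends : ∀ j {a} → a ∈ lookup F j → φ a ∈ lookup H (f j)
  φ-sends j a∈Fj = X⊆ j (nth-∈ X (rank<|X| (lookup⊆concat F j a∈Fj)))

-- Two edges of F sent into distinct pieces of one edge of H would be separated,
-- because φ is increasing.
≻-coarsen : ∀ F D H → NoSeparatedEdges F → (σ : Fin (e D) → Fin (e H)) →
  (∀ s {a} → a ∈ lookup D s → a ∈ lookup H (σ s)) →
  (∀ s t → σ s ≡ σ t → s ≢ t → lookup D s ≺ lookup D t ⊎ lookup D t ≺ lookup D s) →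
  D ≻ F → H ≻ F
≻-coarsen F D H unseparated σ D⊆σ separated (φ , f , φ-mono , f-inj , φ-sends) =
  φ , σ ∘ f , φ-mono , σf-inj , λ j a∈Fj → D⊆σ (f j) (φ-sends j a∈Fj)
  where
  reflect : ∀ j k → lookup D (f j) ≺ lookup D (f k) → lookup F j ≺ lookup F k
  reflect j k Dfj≺Dfk {a} {b} a∈Fj b∈Fk with <-cmp a b
  ... | tri< a<b _ _ = a<b
  ... | tri≈ _ refl _ = ⊥-elim (<-irrefl refl (Dfj≺Dfk (φ-sends j a∈Fj) (φ-sends k b∈Fk)))
  ... | tri> _ _ b<a = ⊥-elim (<-asym (Dfj≺Dfk (φ-sends j a∈Fj) (φ-sends k b∈Fk))
                                      (φ-mono (lookup⊆concat F k b∈Fk) (lookup⊆concat F j a∈Fj) b<a))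
  σf-inj : Injective _≡_ _≡_ (σ ∘ f)
  σf-inj {j} {k} σfj≡σfk with j Fin.≟ k
  ... | yes j≡k = j≡k
  ... | no j≢k with separated (f j) (f k) σfj≡σfk (j≢k ∘ f-inj)
  ...   | inj₁ Dfj≺Dfk = ⊥-elim (unseparated (j , k , reflect j k Dfj≺Dfk))
  ...   | inj₂ Dfk≺Dfj = ⊥-elim (unseparated (k , j , reflect k j Dfk≺Dfj))

1≤v : ∀ F → IsHypergraph F → 0 < e F → 1 ≤ v F
1≤v ([] ∷ F)      ((() , _) ∷ _) _
1≤v ((x ∷ E) ∷ F) _ _ = nonEmpty (∈-deduplicate⁺ _≟_ {xs = concat ((x ∷ E) ∷ F)} (here refl))
  where
  nonEmpty : ∀ {V} → x ∈ V → 1 ≤ length V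
  nonEmpty (here _)  = s≤s z≤n
  nonEmpty (there _) = s≤s z≤n

module Refinement
  (F : Hypergraph) (F-edges : IsHypergraph F) (F-unseparated : NoSeparatedEdges F) (1<q : 1 < e F)
  (H : Hypergraph) (H-edges : IsHypergraph H) (H-simple : Simple H) (H-free : ¬ H ≻ F) where

  p q : ℕ
  p = v F
  q = e F

  0<q : 0 < q
  0<q = <⇒≤ 1<q

  1≤p : 1 ≤ p
  1≤p = 1≤v F F-edges 0<q

  open Blocks p

  _≟L_ : DecidableEquality (List ℕ)
  _≟L_ = ≡-dec _≟_

  open Multiplicity _≟L_ using (count; count-unique; count≤⇒length≤; count-concatMap≤)
  open DecMembership _≟L_ using (_∈?_)

  B : List (List ℕ)
  B = concatMap blocks H

  D : Hypergraph
  D = deduplicate _≟L_ B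

  i≤ : i H ≤ (2 * p ∸ 1) * length B
  i≤ = sum-length≤ 1≤p H

  sorted : ∀ {E} → IsEdge E → AllPairs _<_ E
  sorted (_ , linked) = Linked⇒AllPairs <-trans linked

  block⊆ : ∀ {E X : List ℕ} {a} → X ∈ blocks E → a ∈ X → a ∈ E
  block⊆ {E} X∈ a∈X = subst (_ ∈_) (concat-blocks E) (∈-concat⁺′ a∈X X∈)

  sorted-concat-blocks : ∀ {E} → IsEdge E → AllPairs _<_ (concat (blocks E))
  sorted-concat-blocks {E} E-edge = subst (AllPairs _<_) (sym (concat-blocks E)) (sorted E-edge)

  blocks-≺ : ∀ {E} → IsEdge E → AllPairs _≺_ (blocks E)
  blocks-≺ {E} E-edge = AllPairs-concat⁻-Precedes (blocks E) (sorted-concat-blocks E-edge)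

  blocks-unique : ∀ {E} → IsEdge E → Unique (blocks E)
  blocks-unique E-edge = AllPairs-≺⇒Unique (blocks-nonEmpty 1≤p (proj₁ E-edge)) (blocks-≺ E-edge)

  block-isEdge : ∀ {E X} → IsEdge E → X ∈ blocks E → IsEdge X
  block-isEdge {E} E-edge X∈ =
    All.lookup (blocks-nonEmpty 1≤p (proj₁ E-edge)) X∈ ,
    AllPairs⇒Linked (All.lookup (AllPairs-concat⁻-All (blocks E) (sorted-concat-blocks E-edge)) X∈)

  edge : ∀ t → IsEdge (lookup H t)
  edge t = All.lookup H-edges (∈-lookup t)

  origin : ∀ {X} → X ∈ D → Any ((X ∈_) ∘ blocks) H
  origin X∈D = ∈-concatMap⁻ blocks (∈-deduplicate⁻ _≟L_ B X∈D)

  σ : Fin (e D) → Fin (e H)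
  σ s = Any.index (origin (∈-lookup s))

  D∈blocks-σ : ∀ s → lookup D s ∈ blocks (lookup H (σ s))
  D∈blocks-σ s = lookup-index (origin (∈-lookup s))

  D-unique : Unique D
  D-unique = deduplicate-! _≟L_ B

  D-separated : ∀ s t → σ s ≡ σ t → s ≢ t → lookup D s ≺ lookup D t ⊎ lookup D t ≺ lookup D s
  D-separated s t σs≡σt s≢t =
    AllPairs-∈⇒⊎ (blocks-≺ (edge (σ s))) (D∈blocks-σ s)
      (subst (λ u → lookup D t ∈ blocks (lookup H u)) (sym σs≡σt) (D∈blocks-σ t))
      (s≢t ∘ Unique⇒lookup-injective D-unique)

  vertices-D⊆ : ∀ {a} → a ∈ vertices D → a ∈ vertices H
  vertices-D⊆ a∈ with X , a∈X , X∈D ← ∈-concat⁻′ D (∈-deduplicate⁻ _≟_ (concat D) a∈) =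
    let o = origin X∈D in ∈-deduplicate⁺ _≟_ (lookup⊆concat H (Any.index o) (block⊆ (lookup-index o) a∈X))

  D-edges : IsHypergraph D
  D-edges = All.tabulate λ X∈D → block-isEdge (edge (Any.index (origin X∈D))) (lookup-index (origin X∈D))

  D-free : ¬ D ≻ F
  D-free = H-free ∘ ≻-coarsen F D H F-unseparated σ (λ s → block⊆ (D∈blocks-σ s)) D-separated

  v-D≤v-H : v D ≤ v H
  v-D≤v-H = Multiplicity.Unique-⊆⇒length≤ _≟_ (deduplicate-! _≟_ (concat D)) vertices-D⊆

  D-admissible : ∀ {n} → v H ≤ n → Admissible F n D
  D-admissible vH≤n = D-edges , D-unique , D-free , ≤-trans v-D≤v-H vH≤n

  holders : List ℕ → Hypergraph
  holders X = filter (λ E → X ∈? blocks E) H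

  short-holders : ∀ X → ¬ p ≤ length X → length (holders X) ≤ 1
  short-holders X short = ≤-trans (length-mono-≤ holders⊆copies) (count-unique X H-simple)
    where
    holders⊆copies : holders X ⊆ filter (X ≟L_) H
    holders⊆copies = Sublist.filter⁺ (λ E → X ∈? blocks E) (X ≟L_) {as = H}
      (λ { refl X∈ → whole X∈ }) ⊆-refl
      where
      whole : ∀ {E} → X ∈ blocks E → X ≡ E
      whole X∈ with blocks-long-or-whole _ X∈
      ... | inj₁ long = ⊥-elim (short long)
      ... | inj₂ X≡E  = X≡E

  long-holders : ∀ X → p ≤ length X → length (holders X) < q
  long-holders X long = ≰⇒> λ q≤ → H-free (copy q≤)
    where
    copy : q ≤ length (holders X) → H ≻ F
    copy q≤ with ι , ι-inj , X∈blocks ← filter-index (λ E → X ∈? blocks E) H =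
      ≻-from-shared-subset F H X-sorted long f (inject≤-injective q≤ q≤ _ _ ∘ ι-inj)
        (λ j → block⊆ (X∈blocks _))
      where
      f : Fin q → Fin (e H)
      f j = ι (Fin.inject≤ j q≤)
      X-sorted : AllPairs _<_ X
      X-sorted = sorted (block-isEdge (edge (f (Fin.fromℕ< 0<q))) (X∈blocks _))

  multiplicity≤ : ∀ X → count X B ≤ q ∸ 1
  multiplicity≤ X = ≤-trans (count-concatMap≤ blocks X H (All.map blocks-unique H-edges)) holders≤
    where
    holders≤ : length (holders X) ≤ q ∸ 1
    holders≤ with p ≤? length X
    ... | yes long = <⇒≤∸1 (long-holders X long)
    ... | no short = ≤-trans (short-holders X short) (<⇒≤∸1 1<q)

  |B|≤ : length B ≤ (q ∸ 1) * length D
  |B|≤ = count≤⇒length≤ (q ∸ 1) D multiplicity≤ (∈-deduplicate⁺ _≟L_)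

theorem1 : (F : Hypergraph) → IsHypergraph F → NoSeparatedEdges F →
    1 < e F → (n : ℕ) →
    ∀ m → IsExE F n m →
    ∀ H → Admissible F n H → i H ≤ (2 * v F ∸ 1) * (e F ∸ 1) * m
theorem1 F F-edges F-unseparated 1<q n m (_ , maximal) H (H-edges , H-simple , H-free , vH≤n) = begin
  i H                          ≤⟨ i≤ ⟩
  c * length B                 ≤⟨ *-monoʳ-≤ c |B|≤ ⟩
  c * ((e F ∸ 1) * length D)   ≤⟨ *-monoʳ-≤ c (*-monoʳ-≤ (e F ∸ 1) e-D≤m) ⟩
  c * ((e F ∸ 1) * m)          ≡⟨ *-assoc c (e F ∸ 1) m ⟨
  c * (e F ∸ 1) * m            ∎
  where
  open Refinement F F-edges F-unseparated 1<q H H-edges H-simple H-free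
  open ≤-Reasoning
  c = 2 * v F ∸ 1
  e-D≤m : e D ≤ m
  e-D≤m = maximal D (D-admissible vH≤n)
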